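{- Let $G$ be a polymer graph obtained by point-attaching from pairwise disjoint connected graphs $G_1,\dots,G_k$. Then \[ \pi(G)\leq \prod_{i=1}^{k}\pi(G_i). \]
   Context: Let $G=(V,E)$ be a simple connected graph. A configuration is a function $f:V\to\mathbb{N}\cup\{0\}$, with weight $|f|=\sum_{u\in V}f(u)$. A pebbling step from a vertex $u$ to a neighbor $v$ decreases $f(u)$ by two and increases $f(v)$ by one. A configuration is solvable if for every vertex $v$ there is a (possibly empty) sequence of pebbling steps resulting in at least one pebble on $v$. The pebbling number $\pi(G)$ is the minimum $k$ such that every configuration of weight $k$ is solvable. A polymer graph obtained by point-attaching from pairwise disjoint connected graphs (monomer units) $G_1,\dots,G_k$ is a connected graph constructed by selecting a vertex of $G_1$ and a vertex of $G_2$ and identifying these two vertices, and then continuing inductively, each time identifying a vertex of the graph built so far with a vertex of the next monomer unit. -}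

module Defs where

open import Data.Nat using (ℕ; zero; suc; _+_; _∸_; _≤_; _<_)
open import Data.Fin using (Fin; _↑ˡ_; _↑ʳ_; punchOut)
open import Data.Fin.Properties using (_≟_)
open import Data.List using (List; []; _∷_; _++_; [_]; map; allFin)
open import Data.Nat.ListAction using (sum)
open import Data.Product using (Σ; Σ-syntax; _×_; ∃)
open import Data.Sum using (_⊎_)
open import Relation.Nullary using (¬_; yes; no)
open import Relation.Binary.PropositionalEquality using (_≡_; _≢_)
open import Relation.Binary.Construct.Closure.ReflexiveTransitive using (Star)

record Graph : Set₁ where
  field
    n   : ℕ
    Adj : Fin n → Fin n → Set

open Graph public

Vertex : Graph → Set
Vertex G = Fin (n G)

Simple : Graph → Set
Simple G = (∀ x y → Adj G x y → Adj G y x) × (∀ x → ¬ Adj G x x)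

Connected : Graph → Set
Connected G = (0 < n G) × (∀ x y → Star (Adj G) x y)

Config : Graph → Set
Config G = Vertex G → ℕ

weight : (G : Graph) → Config G → ℕ
weight G f = sum (map f (allFin (n G)))

-- Result of a pebbling step from u to v (u ≢ v since the graph is simple)
move : {G : Graph} → Config G → Vertex G → Vertex G → Config G
move f u v x with x ≟ u
... | yes _ = f x ∸ 2
... | no _ with x ≟ v
...   | yes _ = suc (f x)
...   | no _ = f x

data Reach {G : Graph} (f : Config G) : Config G → Set where
  here : Reach {G} f f
  step : ∀ {g} u v → Reach {G} f g → Adj G u v → 2 ≤ g u → Reach f (move {G} g u v)

Solvable : (G : Graph) → Config G → Set
Solvable G f = ∀ r → Σ[ g ∈ Config G ] (Reach {G} f g × 1 ≤ g r)

AllSolvable : Graph → ℕ → Set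
AllSolvable G k = ∀ (f : Config G) → weight G f ≡ k → Solvable G f

IsPebblingNumber : Graph → ℕ → Set
IsPebblingNumber G k = AllSolvable G k × (∀ j → j < k → ¬ AllSolvable G j)

-- Point-attaching: identify vertex u of G with vertex w of H.
-- Vertex set of the result: Fin (n G + (n H ∸ 1)); G embeds via inject+,
-- H embeds by sending w to u and the other vertices (via punchOut) into the upper part.
embL : ∀ {n} m → Fin n → Fin (n + (m ∸ 1))
embL m u = u ↑ˡ (m ∸ 1)

embR : ∀ {n m} → Fin n → Fin m → Fin m → Fin (n + (m ∸ 1))
embR {n} {suc m} u w j with w ≟ j
... | yes _ = u ↑ˡ m
... | no w≢j = n ↑ʳ punchOut w≢j

attach : (G H : Graph) → Vertex G → Vertex H → Graph
attach G H u w = record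
  { n = n G + (n H ∸ 1)
  ; Adj = λ x y →
      (Σ[ a ∈ Vertex G ] Σ[ b ∈ Vertex G ]
         (embL (n H) a ≡ x × embL (n H) b ≡ y × Adj G a b))
      ⊎
      (Σ[ a ∈ Vertex H ] Σ[ b ∈ Vertex H ]
         (embR u w a ≡ x × embR u w b ≡ y × Adj H a b))
  }

data Polymer : List Graph → Graph → Set₁ where
  mono   : ∀ G → Polymer [ G ] G
  glue : ∀ {Gs G} H → Polymer Gs G → (u : Vertex G) → (w : Vertex H) →
           Polymer (Gs ++ [ H ]) (attach G H u w)

{-# OPTIONS --safe #-}
-- If every weight-p configuration of A₁ and every weight-q configuration of A₂ is solvable,
-- so is every weight-pq configuration of the graph obtained by gluing them at a cut vertex c.
-- For a target on the A₁ side, which holds b < p pebbles, the far side holds pq − b ≥ (p − b)q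
-- pebbles; each batch of q of them can be pebbled inside A₂ onto c, so after p − b rounds the
-- A₁ side holds p pebbles and A₁ alone reaches the target.  Induction along the polymer gives
-- solvability at weight ∏ π(Gᵢ), and minimality of π(G) gives the bound.
module Submission where

open import Defs
open import Data.Nat using (ℕ; _≤_)
open import Data.List using (List)
open import Data.Nat.ListAction using (product)
open import Data.List.Relation.Unary.All using (All)
open import Data.List.Relation.Binary.Pointwise using (Pointwise)
open import Data.Product using (_×_)

open import Data.Nat using (zero; suc; _+_; _*_; _∸_; _⊓_; z≤n; s≤s)
open import Data.Nat.Properties hiding (_≟_)
open import Data.Nat.ListAction.Properties using (product-++)
import Data.Nat.ListAction as List
import Data.Fin as Fin
open import Data.Fin using (Fin; _↑ˡ_; _↑ʳ_; splitAt; punchIn)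
open import Data.Fin.Properties
  using (_≟_; ↑ˡ-injective; ↑ʳ-injective; splitAt-↑ˡ; splitAt-↑ʳ; splitAt⁻¹-↑ˡ; splitAt⁻¹-↑ʳ;
         punchInᵢ≢i; punchOut-cong; punchOut-punchIn; punchOut-injective)
open import Data.Vec.Functional using (Vector; updateAt; removeAt)
open import Data.Vec.Functional.Properties using (updateAt-updates; updateAt-minimal)
open import Data.List using ([]; _∷_; _++_; [_]; tabulate)
open import Data.List.Properties using (map-tabulate)
open import Data.List.Relation.Binary.Pointwise using ([]; _∷_) renaming (map to Pointwise-map)
open import Data.Product using (Σ-syntax; ∃; _,_; proj₁)
open import Data.Sum using (_⊎_; inj₁; inj₂; swap)
open import Function using (_∘_; id; const)
open import Function.Definitions using (Injective)
open import Relation.Nullary using (yes; no; contradiction)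
open import Relation.Binary.PropositionalEquality hiding ([_])
open import Algebra.Properties.CommutativeMonoid.Sum +-0-commutativeMonoid
  using (sum; sum-cong-≗; sum-remove; ∑-distrib-+)
open import Algebra.Properties.CommutativeSemigroup +-commutativeSemigroup using (xy∙z≈xz∙y)

sum-mono-≤ : ∀ {n} {f g : Vector ℕ n} → (∀ i → f i ≤ g i) → sum f ≤ sum g
sum-mono-≤ {zero}  f≤g = z≤n
sum-mono-≤ {suc n} f≤g = +-mono-≤ (f≤g Fin.zero) (sum-mono-≤ (f≤g ∘ Fin.suc))

sum-∸ : ∀ {n} {f g : Vector ℕ n} → (∀ i → g i ≤ f i) → sum (λ i → f i ∸ g i) ≡ sum f ∸ sum g
sum-∸ {f = f} {g} g≤f = begin
  sum (λ i → f i ∸ g i)                      ≡⟨ m+n∸n≡m _ (sum g) ⟨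
  sum (λ i → f i ∸ g i) + sum g ∸ sum g      ≡⟨ cong (_∸ sum g) (∑-distrib-+ (λ i → f i ∸ g i) g) ⟨
  sum (λ i → f i ∸ g i + g i) ∸ sum g        ≡⟨ cong (_∸ sum g) (sum-cong-≗ (λ i → m∸n+n≡m (g≤f i))) ⟩
  sum f ∸ sum g                              ∎
  where open ≡-Reasoning

sum-↑ : ∀ N {m} (F : Vector ℕ (N + m)) → sum F ≡ sum (F ∘ (_↑ˡ m)) + sum (F ∘ (N ↑ʳ_))
sum-↑ zero    F = refl
sum-↑ (suc N) F = trans (cong (F Fin.zero +_) (sum-↑ N (F ∘ Fin.suc))) (sym (+-assoc (F Fin.zero) _ _))

subvector-with-sum : ∀ {n} (F : Vector ℕ n) {k} → k ≤ sum F →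
                     Σ[ f ∈ Vector ℕ n ] ((∀ i → f i ≤ F i) × sum f ≡ k)
subvector-with-sum {zero}  F {zero} _ = (λ ()) , (λ ()) , refl
subvector-with-sum {suc n} F {k} k≤ΣF with subvector-with-sum (F ∘ Fin.suc) (m⊓n≤m (sum (F ∘ Fin.suc)) k)
... | f , f≤ , Σf = f′ , f′≤F , Σf′≡k
  where
  s : ℕ
  s = sum (F ∘ Fin.suc)
  f′ : Vector ℕ (suc n)
  f′ Fin.zero    = k ∸ s
  f′ (Fin.suc i) = f i
  f′≤F : ∀ i → f′ i ≤ F i
  f′≤F Fin.zero    = m≤n+o⇒m∸n≤o k s (subst (k ≤_) (+-comm (F Fin.zero) s) k≤ΣF)
  f′≤F (Fin.suc i) = f≤ i
  Σf′≡k : sum f′ ≡ k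
  Σf′≡k = trans (cong (k ∸ s +_) Σf) (trans (+-comm (k ∸ s) (s ⊓ k)) (m⊓n+n∸m≡n s k))

weight-sum : ∀ G (f : Config G) → weight G f ≡ sum f
weight-sum G f = trans (cong List.sum (map-tabulate id f)) (sum-tabulate f)
  where
  sum-tabulate : ∀ {n} (h : Vector ℕ n) → List.sum (tabulate h) ≡ sum h
  sum-tabulate {zero}  h = refl
  sum-tabulate {suc n} h = cong (h Fin.zero +_) (sum-tabulate (h ∘ Fin.suc))

erase : ∀ {n} → Fin n → Vector ℕ n → Vector ℕ n
erase c f = updateAt f c (const 0)

erase-self : ∀ {n} (c : Fin n) f → erase c f c ≡ 0
erase-self c f = updateAt-updates c f

erase-≡ : ∀ {n} {c : Fin n} f {x} → x ≢ c → erase c f x ≡ f x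
erase-≡ {c = c} f {x} x≢c = updateAt-minimal x c f x≢c

erase-≤ : ∀ {n} (c : Fin n) f x → erase c f x ≤ f x
erase-≤ c f x with x ≟ c
... | yes refl = ≤-trans (≤-reflexive (erase-self c f)) z≤n
... | no x≢c   = ≤-reflexive (erase-≡ f x≢c)

erase-mono-≤ : ∀ {n} (c : Fin n) {f g : Vector ℕ n} → (∀ x → x ≢ c → f x ≤ g x) →
               ∀ x → erase c f x ≤ erase c g x
erase-mono-≤ c {f} {g} f≤g x with x ≟ c
... | yes refl = ≤-reflexive (trans (erase-self c f) (sym (erase-self c g)))
... | no x≢c   = subst₂ _≤_ (sym (erase-≡ f x≢c)) (sym (erase-≡ g x≢c)) (f≤g x x≢c)

erase-∸ : ∀ {n} (c : Fin n) (f g : Vector ℕ n) x → erase c f x ∸ g x ≡ erase c (λ y → f y ∸ g y) x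
erase-∸ c f g x with x ≟ c
... | yes refl = trans (cong (_∸ g c) (erase-self c f)) (trans (0∸n≡0 (g c)) (sym (erase-self c _)))
... | no x≢c   = trans (cong (_∸ g x) (erase-≡ f x≢c)) (sym (erase-≡ _ x≢c))

sum-erase≡sum-removeAt : ∀ {n} (c : Fin (suc n)) f → sum (erase c f) ≡ sum (removeAt f c)
sum-erase≡sum-removeAt c f = begin
  sum (erase c f)                                  ≡⟨ sum-remove (erase c f) ⟩
  erase c f c + sum (removeAt (erase c f) c)       ≡⟨ cong₂ _+_ (erase-self c f)
                                                         (sum-cong-≗ λ j → erase-≡ f (punchInᵢ≢i c j)) ⟩
  sum (removeAt f c)                               ∎
  where open ≡-Reasoning

sum-erase : ∀ {n} (c : Fin n) f → sum f ≡ f c + sum (erase c f)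
sum-erase {suc n} c f = trans (sum-remove f) (cong (f c +_) (sym (sum-erase≡sum-removeAt c f)))

reach-trans : ∀ {G} {f g h : Config G} → Reach {G} f g → Reach {G} g h → Reach {G} f h
reach-trans f↝g here                = f↝g
reach-trans f↝g (step u v g↝h uv 2≤) = step u v (reach-trans f↝g g↝h) uv 2≤

SolvableAt : (G : Graph) → Config G → Vertex G → Set
SolvableAt G f r = Σ[ g ∈ Config G ] (Reach {G} f g × 1 ≤ g r)

move-other : ∀ {G} (f : Config G) {u v x} → x ≢ u → x ≢ v → move {G} f u v x ≡ f x
move-other f {u} {v} {x} x≢u x≢v with x ≟ u
... | yes x≡u = contradiction x≡u x≢u
... | no _ with x ≟ v
...   | yes x≡v = contradiction x≡v x≢v
...   | no _    = refl

move-∘ : ∀ {A B} (ι : Vertex A → Vertex B) → Injective _≡_ _≡_ ι →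
         ∀ (F : Config B) u v x → move {B} F (ι u) (ι v) (ι x) ≡ move {A} (F ∘ ι) u v x
move-∘ ι ι-inj F u v x with x ≟ u | ι x ≟ ι u
... | yes _   | yes _     = refl
... | yes x≡u | no ιx≢ιu  = contradiction (cong ι x≡u) ιx≢ιu
... | no x≢u  | yes ιx≡ιu = contradiction (ι-inj ιx≡ιu) x≢u
... | no _    | no _ with x ≟ v | ι x ≟ ι v
...   | yes _   | yes _     = refl
...   | yes x≡v | no ιx≢ιv  = contradiction (cong ι x≡v) ιx≢ιv
...   | no x≢v  | yes ιx≡ιv = contradiction (ι-inj ιx≡ιv) x≢v
...   | no _    | no _      = refl

move-mono : ∀ {G} {g d F : Config G} {u} v → (∀ x → g x + d x ≤ F x) → 2 ≤ g u →
            ∀ x → move {G} g u v x + d x ≤ move {G} F u v x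
move-mono {g = g} {d} {F} {u} v g+d≤F 2≤gu x with x ≟ u
... | yes refl = subst (_≤ F u ∸ 2) (+-∸-comm (d u) 2≤gu) (∸-monoˡ-≤ 2 (g+d≤F u))
... | no _ with x ≟ v
...   | yes _ = s≤s (g+d≤F x)
...   | no _  = g+d≤F x

record _↪_ (A B : Graph) : Set where
  field
    vertex    : Vertex A → Vertex B
    injective : Injective _≡_ _≡_ vertex
    adjacent  : ∀ {x y} → Adj A x y → Adj B (vertex x) (vertex y)

open _↪_

reach-lift : ∀ {A B} (ι : A ↪ B) {f g d : Config A} {F : Config B} →
             (∀ x → f x + d x ≤ F (vertex ι x)) → Reach {A} f g →
             Σ[ G ∈ Config B ] (Reach {B} F G × (∀ x → g x + d x ≤ G (vertex ι x))
                               × (∀ y → (∀ x → vertex ι x ≢ y) → F y ≤ G y))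
reach-lift ι f+d≤F here = _ , here , f+d≤F , λ _ _ → ≤-refl
reach-lift {A} {B} ι {d = d} {F} f+d≤F (step {h} u v f↝h uv 2≤hu) with reach-lift ι f+d≤F f↝h
... | G , F↝G , h+d≤G , off≤G = move {B} G (ι′ u) (ι′ v) , F↝G′ , g+d≤G′ , off≤G′
  where
  ι′ : Vertex A → Vertex B
  ι′ = vertex ι
  F↝G′ : Reach {B} F (move {B} G (ι′ u) (ι′ v))
  F↝G′ = step (ι′ u) (ι′ v) F↝G (adjacent ι uv) (≤-trans 2≤hu (≤-trans (m≤m+n (h u) (d u)) (h+d≤G u)))
  g+d≤G′ : ∀ x → move {A} h u v x + d x ≤ move G (ι′ u) (ι′ v) (ι′ x)
  g+d≤G′ x = subst (_ ≤_) (sym (move-∘ ι′ (injective ι) G u v x)) (move-mono v h+d≤G 2≤hu x)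
  off≤G′ : ∀ y → (∀ x → ι′ x ≢ y) → F y ≤ move G (ι′ u) (ι′ v) y
  off≤G′ y ∉ι = ≤-trans (off≤G y ∉ι) (≤-reflexive (sym (move-other G (∉ι u ∘ sym) (∉ι v ∘ sym))))

record PointAttached (B A₁ A₂ : Graph) : Set where
  field
    ι₁           : A₁ ↪ B
    ι₂           : A₂ ↪ B
    c₁           : Vertex A₁
    c₂           : Vertex A₂
    glued        : vertex ι₁ c₁ ≡ vertex ι₂ c₂
    meet-at-cut  : ∀ {x y} → vertex ι₁ x ≡ vertex ι₂ y → x ≡ c₁
    covers       : ∀ r → (∃ λ x → vertex ι₁ x ≡ r) ⊎ (∃ λ y → vertex ι₂ y ≡ r)
    weight-split : ∀ (F : Config B) → sum F ≡ sum (F ∘ vertex ι₁) + sum (erase c₂ (F ∘ vertex ι₂))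

PointAttached-swap : ∀ {B A₁ A₂} → PointAttached B A₁ A₂ → PointAttached B A₂ A₁
PointAttached-swap {B} P = record
  { ι₁           = ι₂
  ; ι₂           = ι₁
  ; c₁           = c₂
  ; c₂           = c₁
  ; glued        = sym glued
  ; meet-at-cut  = λ e → injective ι₂ (trans e (trans (cong (vertex ι₁) (meet-at-cut (sym e))) glued))
  ; covers       = swap ∘ covers
  ; weight-split = weight-split′
  }
  where
  open PointAttached P
  weight-split′ : ∀ (F : Config B) → sum F ≡ sum (F ∘ vertex ι₂) + sum (erase c₁ (F ∘ vertex ι₁))
  weight-split′ F = begin
    sum F                                   ≡⟨ weight-split F ⟩
    sum (F ∘ vertex ι₁) + E₂                ≡⟨ cong (_+ E₂) (sum-erase c₁ (F ∘ vertex ι₁)) ⟩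
    F (vertex ι₁ c₁) + E₁ + E₂              ≡⟨ cong (λ r → F r + E₁ + E₂) glued ⟩
    F (vertex ι₂ c₂) + E₁ + E₂              ≡⟨ xy∙z≈xz∙y (F (vertex ι₂ c₂)) E₁ E₂ ⟩
    F (vertex ι₂ c₂) + E₂ + E₁              ≡⟨ cong (_+ E₁) (sum-erase c₂ (F ∘ vertex ι₂)) ⟨
    sum (F ∘ vertex ι₂) + E₁                ∎
    where
    open ≡-Reasoning
    E₁ E₂ : ℕ
    E₁ = sum (erase c₁ (F ∘ vertex ι₁))
    E₂ = sum (erase c₂ (F ∘ vertex ι₂))

m+n≡o*p⇒[o∸m]*p≤n : ∀ m n o p → m + n ≡ o * p → (o ∸ m) * p ≤ n
m+n≡o*p⇒[o∸m]*p≤n m n o zero    _ = ≤-trans (≤-reflexive (*-zeroʳ (o ∸ m))) z≤n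
m+n≡o*p⇒[o∸m]*p≤n m n o p@(suc _) m+n≡o*p = begin
  (o ∸ m) * p    ≡⟨ *-distribʳ-∸ p o m ⟩
  o * p ∸ m * p  ≤⟨ ∸-monoʳ-≤ (o * p) (m≤m*n m p) ⟩
  o * p ∸ m      ≡⟨ cong (_∸ m) m+n≡o*p ⟨
  m + n ∸ m      ≡⟨ m+n∸m≡n m n ⟩
  n              ∎
  where open ≤-Reasoning

module PointAttachedPebbling {B A₁ A₂ : Graph} (P : PointAttached B A₁ A₂) where
  open PointAttached P

  cut : Vertex B
  cut = vertex ι₁ c₁

  near : Config B → Config A₁
  near F = F ∘ vertex ι₁

  farWeight : Config B → ℕ
  farWeight F = sum (erase c₂ (F ∘ vertex ι₂))

  record Gains (k : ℕ) (F G : Config B) : Set where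
    constructor gains
    field
      at-cut  : F cut + k ≤ G cut
      off-cut : ∀ x → x ≢ c₁ → near F x ≤ near G x

  Gains-refl : ∀ F → Gains 0 F F
  Gains-refl F = gains (≤-reflexive (+-identityʳ (F cut))) λ _ _ → ≤-refl

  Gains-trans : ∀ {j k F G H} → Gains j F G → Gains k G H → Gains (j + k) F H
  Gains-trans {j} {k} {F} (gains F+j≤G F≤G) (gains G+k≤H G≤H) = gains
    (≤-trans (≤-reflexive (sym (+-assoc (F cut) j k))) (≤-trans (+-monoˡ-≤ k F+j≤G) G+k≤H))
    λ x x≢c₁ → ≤-trans (F≤G x x≢c₁) (G≤H x x≢c₁)

  Gains⇒weight : ∀ {k F G} → Gains k F G → sum (near F) + k ≤ sum (near G)
  Gains⇒weight {k} {F} {G} (gains F+k≤G F≤G) = begin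
    sum (near F) + k                          ≡⟨ cong (_+ k) (sum-erase c₁ (near F)) ⟩
    F cut + sum (erase c₁ (near F)) + k       ≡⟨ xy∙z≈xz∙y (F cut) _ k ⟩
    F cut + k + sum (erase c₁ (near F))       ≤⟨ +-mono-≤ F+k≤G (sum-mono-≤ (erase-mono-≤ c₁ F≤G)) ⟩
    G cut + sum (erase c₁ (near G))           ≡⟨ sum-erase c₁ (near G) ⟨
    sum (near G)                              ∎
    where open ≤-Reasoning

  module _ {q} (solvable₂ : AllSolvable A₂ q) where

    -- Solve A₂ for c₂ from q far-side pebbles, leaving the pebbles already on the cut vertex aside.
    pebble-to-cut : ∀ F → q ≤ farWeight F →
                    Σ[ G ∈ Config B ] (Reach {B} F G × Gains 1 F G × farWeight F ∸ q ≤ farWeight G)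
    pebble-to-cut F q≤far with subvector-with-sum (erase c₂ (F ∘ vertex ι₂)) q≤far
    ... | f , f≤ , Σf≡q with solvable₂ f (trans (weight-sum A₂ f) Σf≡q) c₂
    ... | g , f↝g , 1≤gc₂ with reach-lift ι₂ {d = d} (λ y → ≤-reflexive (m+[n∸m]≡n (f≤F y))) f↝g
      where
      f≤F : ∀ y → f y ≤ F (vertex ι₂ y)
      f≤F y = ≤-trans (f≤ y) (erase-≤ c₂ (F ∘ vertex ι₂) y)
      d : Config A₂
      d y = F (vertex ι₂ y) ∸ f y
    ... | G , F↝G , g+d≤G , off≤G = G , F↝G , gains gain-at-cut gain-off-cut , far-loss
      where
      fc₂≡0 : f c₂ ≡ 0
      fc₂≡0 = n≤0⇒n≡0 (≤-trans (f≤ c₂) (≤-reflexive (erase-self c₂ (F ∘ vertex ι₂))))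
      gain-at-cut : F cut + 1 ≤ G cut
      gain-at-cut = begin
        F cut + 1                                   ≡⟨ +-comm (F cut) 1 ⟩
        1 + F cut                                   ≡⟨ cong (λ r → 1 + F r) glued ⟩
        1 + F (vertex ι₂ c₂)                        ≡⟨ cong (λ z → 1 + (F (vertex ι₂ c₂) ∸ z)) fc₂≡0 ⟨
        1 + (F (vertex ι₂ c₂) ∸ f c₂)               ≤⟨ +-monoˡ-≤ _ 1≤gc₂ ⟩
        g c₂ + (F (vertex ι₂ c₂) ∸ f c₂)            ≤⟨ g+d≤G c₂ ⟩
        G (vertex ι₂ c₂)                            ≡⟨ cong G glued ⟨
        G cut                                       ∎
        where open ≤-Reasoning
      gain-off-cut : ∀ x → x ≢ c₁ → F (vertex ι₁ x) ≤ G (vertex ι₁ x)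
      gain-off-cut x x≢c₁ = off≤G (vertex ι₁ x) λ y ι₂y≡ι₁x → x≢c₁ (meet-at-cut (sym ι₂y≡ι₁x))
      far-loss : farWeight F ∸ q ≤ farWeight G
      far-loss = begin
        farWeight F ∸ q                                        ≡⟨ cong (farWeight F ∸_) Σf≡q ⟨
        farWeight F ∸ sum f                                    ≡⟨ sum-∸ f≤ ⟨
        sum (λ y → erase c₂ (F ∘ vertex ι₂) y ∸ f y)           ≤⟨ sum-mono-≤ far-pointwise ⟩
        farWeight G                                            ∎
        where
        open ≤-Reasoning
        far-pointwise : ∀ y → erase c₂ (F ∘ vertex ι₂) y ∸ f y ≤ erase c₂ (G ∘ vertex ι₂) y
        far-pointwise y = ≤-trans (≤-reflexive (erase-∸ c₂ (F ∘ vertex ι₂) f y))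
          (erase-mono-≤ c₂ (λ y _ → ≤-trans (m≤n+m _ (g y)) (g+d≤G y)) y)

    gather : ∀ k F → k * q ≤ farWeight F → Σ[ G ∈ Config B ] (Reach {B} F G × Gains k F G)
    gather zero    F _        = F , here , Gains-refl F
    gather (suc k) F kq+q≤far with pebble-to-cut F (≤-trans (m≤m+n q (k * q)) kq+q≤far)
    ... | G , F↝G , gain₁ , far-loss with gather k G (≤-trans kq≤far-q far-loss)
      where
      kq≤far-q : k * q ≤ farWeight F ∸ q
      kq≤far-q = ≤-trans (≤-reflexive (sym (m+n∸m≡n q (k * q)))) (∸-monoˡ-≤ q kq+q≤far)
    ... | H , G↝H , gainₖ = H , reach-trans {B} F↝G G↝H , Gains-trans gain₁ gainₖ

  solvable-near-side : ∀ {p q} → AllSolvable A₁ p → AllSolvable A₂ q →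
                       ∀ F → sum F ≡ p * q → ∀ x → SolvableAt B F (vertex ι₁ x)
  solvable-near-side {p} {q} solvable₁ solvable₂ F ΣF≡pq x
    with gather solvable₂ (p ∸ sum (near F)) F (m+n≡o*p⇒[o∸m]*p≤n (sum (near F)) (farWeight F) p q
                                                  (trans (sym (weight-split F)) ΣF≡pq))
  ... | G , F↝G , gain with subvector-with-sum (near G) (≤-trans (m≤n+m∸n p (sum (near F))) (Gains⇒weight gain))
  ... | f , f≤G , Σf≡p with solvable₁ f (trans (weight-sum A₁ f) Σf≡p) x
  ... | g , f↝g , 1≤gx with reach-lift ι₁ {d = const 0} (λ y → ≤-trans (≤-reflexive (+-identityʳ (f y))) (f≤G y)) f↝g
  ... | H , G↝H , g≤H , _ = H , reach-trans {B} F↝G G↝H , ≤-trans 1≤gx (≤-trans (m≤m+n (g x) 0) (g≤H x))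

solvable-pointAttached : ∀ {B A₁ A₂ p q} → PointAttached B A₁ A₂ →
                         AllSolvable A₁ p → AllSolvable A₂ q → AllSolvable B (p * q)
solvable-pointAttached {B} {p = p} {q} P solvable₁ solvable₂ F wF≡pq r = solve-at (covers r)
  where
  open PointAttached P
  ΣF≡pq : sum F ≡ p * q
  ΣF≡pq = trans (sym (weight-sum B F)) wF≡pq
  solve-at : (∃ λ x → vertex ι₁ x ≡ r) ⊎ (∃ λ y → vertex ι₂ y ≡ r) → SolvableAt B F r
  solve-at (inj₁ (x , refl)) = PointAttachedPebbling.solvable-near-side P solvable₁ solvable₂ F ΣF≡pq x
  solve-at (inj₂ (y , refl)) = PointAttachedPebbling.solvable-near-side (PointAttached-swap P)
                                 solvable₂ solvable₁ F (trans ΣF≡pq (*-comm p q)) y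

↑ˡ≢↑ʳ : ∀ N {m} (i : Fin N) (j : Fin m) → i ↑ˡ m ≢ N ↑ʳ j
↑ˡ≢↑ʳ N {m} i j i↑ˡm≡N↑ʳj
  with () ← trans (sym (splitAt-↑ˡ N i m)) (trans (cong (splitAt N) i↑ˡm≡N↑ʳj) (splitAt-↑ʳ N m j))

module _ {N m : ℕ} (u : Fin N) (w : Fin (suc m)) where

  embR-cut : embR u w w ≡ u ↑ˡ m
  embR-cut with w ≟ w
  ... | yes _  = refl
  ... | no w≢w = contradiction refl w≢w

  embR-punchIn : ∀ j → embR u w (punchIn w j) ≡ N ↑ʳ j
  embR-punchIn j with w ≟ punchIn w j
  ... | yes w≡wj = contradiction (sym w≡wj) (punchInᵢ≢i w j)
  ... | no w≢wj  = cong (N ↑ʳ_) (trans (punchOut-cong w refl) (punchOut-punchIn w))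

  embR-injective : Injective _≡_ _≡_ (embR u w)
  embR-injective {x} {y} e with w ≟ x | w ≟ y
  ... | yes w≡x | yes w≡y = trans (sym w≡x) w≡y
  ... | yes _   | no _    = contradiction e (↑ˡ≢↑ʳ N u _)
  ... | no _    | yes _   = contradiction (sym e) (↑ˡ≢↑ʳ N u _)
  ... | no w≢x  | no w≢y  = punchOut-injective w≢x w≢y (↑ʳ-injective N _ _ e)

  embL≡embR⇒cut : ∀ {x y} → x ↑ˡ m ≡ embR u w y → x ≡ u
  embL≡embR⇒cut {x} {y} e with w ≟ y
  ... | yes _ = ↑ˡ-injective m x u e
  ... | no _  = contradiction e (↑ˡ≢↑ʳ N x _)

attach-pointAttached : ∀ G H u w → PointAttached (attach G H u w) G H
attach-pointAttached G (record { n = zero })  u ()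
attach-pointAttached G H@(record { n = suc m }) u w = record
  { ι₁           = record { vertex = _↑ˡ m ; injective = ↑ˡ-injective m _ _
                          ; adjacent = λ xy → inj₁ (_ , _ , refl , refl , xy) }
  ; ι₂           = record { vertex = embR u w ; injective = embR-injective u w
                          ; adjacent = λ xy → inj₂ (_ , _ , refl , refl , xy) }
  ; c₁           = u
  ; c₂           = w
  ; glued        = sym (embR-cut u w)
  ; meet-at-cut  = embL≡embR⇒cut u w
  ; covers       = covers
  ; weight-split = weight-split
  }
  where
  B : Graph
  B = attach G H u w
  covers : ∀ r → (∃ λ x → x ↑ˡ m ≡ r) ⊎ (∃ λ y → embR u w y ≡ r)
  covers r with splitAt (n G) r in eq
  ... | inj₁ x = inj₁ (x , splitAt⁻¹-↑ˡ eq)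
  ... | inj₂ j = inj₂ (punchIn w j , trans (embR-punchIn u w j) (splitAt⁻¹-↑ʳ eq))
  weight-split : ∀ (F : Config B) → sum F ≡ sum (F ∘ (_↑ˡ m)) + sum (erase w (F ∘ embR u w))
  weight-split F = trans (sum-↑ (n G) F) (cong (sum (F ∘ (_↑ˡ m)) +_) (sym (begin
    sum (erase w (F ∘ embR u w))        ≡⟨ sum-erase≡sum-removeAt w (F ∘ embR u w) ⟩
    sum (F ∘ embR u w ∘ punchIn w)      ≡⟨ sum-cong-≗ (cong F ∘ embR-punchIn u w) ⟩
    sum (F ∘ (n G ↑ʳ_))                 ∎)))
    where open ≡-Reasoning

Pointwise-++⁻ : ∀ {a b ℓ} {A : Set a} {B : Set b} {R : A → B → Set ℓ} xs {ys zs} →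
                Pointwise R (xs ++ ys) zs →
                Σ[ zs₁ ∈ List B ] Σ[ zs₂ ∈ List B ]
                  (zs ≡ zs₁ ++ zs₂ × Pointwise R xs zs₁ × Pointwise R ys zs₂)
Pointwise-++⁻ []       rs       = [] , _ , refl , [] , rs
Pointwise-++⁻ (x ∷ xs) (r ∷ rs) with Pointwise-++⁻ xs rs
... | zs₁ , zs₂ , refl , rs₁ , rs₂ = _ ∷ zs₁ , zs₂ , refl , r ∷ rs₁ , rs₂

polymer-solvable : ∀ {Gs G} → Polymer Gs G → ∀ {ps} → Pointwise AllSolvable Gs ps → AllSolvable G (product ps)
polymer-solvable (mono G) (s ∷ []) = subst (AllSolvable G) (sym (*-identityʳ _)) s
polymer-solvable (glue {Gs} {G} H P u w) pw with Pointwise-++⁻ Gs pw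
... | ps , q ∷ [] , refl , pw-Gs , s ∷ [] =
  subst (AllSolvable (attach G H u w)) (sym (trans (product-++ ps [ q ]) (cong (product ps *_) (*-identityʳ q))))
        (solvable-pointAttached (attach-pointAttached G H u w) (polymer-solvable P pw-Gs) s)

mainTheorem5 : (Gs : List Graph) (G : Graph) → Polymer Gs G →
    All (λ H → Simple H × Connected H) Gs →
    (ps : List ℕ) → Pointwise IsPebblingNumber Gs ps →
    (p : ℕ) → IsPebblingNumber G p →
    p ≤ product ps
mainTheorem5 Gs G P _ ps πs p (_ , minimal) =
  ≮⇒≥ λ ∏ps<p → minimal (product ps) ∏ps<p (polymer-solvable P (Pointwise-map proj₁ πs))
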